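{- Let $(G,Z)$ be a dyadic plantation. Then there exists $X\subseteq Z$ with $|X|\le 2\phi(s)$ such that exploding the vertices of $X$ yields a dyadic plantation with at most $2|Z|$ binary vertices.
   Context: Fix an integer $s\ge1$. Graphs are finite and simple. Two vertex sets are anticomplete if they are disjoint with no edges between them. A graph is $s\mathcal{O}$-free if no $s$ cycles of it are pairwise vertex-disjoint and pairwise anticomplete. $Z\subseteq V(G)$ is cycle-hitting if every cycle of $G$ meets $Z$. A plantation is a pair $(G,Z)$ with $G$ an $s\mathcal{O}$-free graph and $Z\subseteq V(G)$ cycle-hitting. $(G,Z)$ is dyadic if $Z$ is stable and every vertex of $V(G)\setminus Z$ has at most two neighbours in $Z$; a vertex of $V(G)\setminus Z$ is binary if it has exactly two neighbours in $Z$. Exploding $z\in Z$ produces $(G',Z\setminus\{z\})$ where $G'$ is obtained from $G$ by deleting $z$ and all its neighbours in $V(G)\setminus Z$. $\phi(s)$ denotes a nonnegative integer (which exists by the Erdős–Pósa theorem) such that every multigraph (loops and parallel edges allowed) with no $s$ pairwise vertex-disjoint cycles has a set of at most $\phi(s)$ vertices meeting every cycle. -}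

module Defs where

open import Data.Nat using (ℕ; zero; suc; _+_; _*_; _≤_; _≡ᵇ_)
open import Data.Bool using (Bool; true; false; _∧_; not)
open import Data.Fin using (Fin)
open import Data.Fin.Subset using (Subset; _∈_; _∉_; _⊆_; ∁; _∩_; _∪_; _─_; ∣_∣; ⊤)
open import Data.List using (List; []; _∷_; _++_)
open import Data.List.Relation.Unary.All using (All)
open import Data.List.Relation.Unary.Any using (Any)
open import Data.List.Relation.Unary.Unique.Propositional using (Unique)
import Data.List.Membership.Propositional as LM
open import Data.List using (length)
open import Data.Vec using (tabulate; lookup)
open import Data.Product using (Σ; _×_; _,_)
open import Data.Sum using (_⊎_)
open import Data.Unit using () renaming (⊤ to Unit)
open import Data.Empty using () renaming (⊥ to Empty)
open import Relation.Binary.PropositionalEquality using (_≡_; _≢_)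
open import Relation.Nullary using (¬_)

record Graph (n : ℕ) : Set where
  field
    adj    : Fin n → Fin n → Bool
    sym    : ∀ u v → adj u v ≡ adj v u
    irrefl : ∀ v → adj v v ≡ false
open Graph public

N : ∀ {n} → Graph n → Fin n → Subset n
N G v = tabulate (adj G v)

NSet : ∀ {n} → Graph n → Subset n → Subset n
NSet G X = tabulate (λ v → not (∣ N G v ∩ X ∣ ≡ᵇ 0))

-- A cycle is given by its cyclic vertex sequence x ∷ xs:
-- at least 3 distinct vertices, all in W, consecutive ones adjacent,
-- and the last one adjacent to the first.

ChainAdj : ∀ {n} → Graph n → List (Fin n) → Set
ChainAdj G []            = Unit
ChainAdj G (x ∷ [])      = Unit
ChainAdj G (x ∷ y ∷ r)   = (adj G x y ≡ true) × ChainAdj G (y ∷ r)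

IsCycle : ∀ {n} → Graph n → Subset n → Fin n → List (Fin n) → Set
IsCycle G W x xs =
  (2 ≤ length xs) × Unique (x ∷ xs) × All (_∈ W) (x ∷ xs)
  × ChainAdj G (x ∷ xs ++ x ∷ [])

record Cycle {n} (G : Graph n) (W : Subset n) : Set where
  constructor cyc
  field
    start : Fin n
    rest  : List (Fin n)
    isCycle : IsCycle G W start rest

verts : ∀ {n} {G : Graph n} {W : Subset n} → Cycle G W → List (Fin n)
verts (cyc x xs _) = x ∷ xs

Anticomplete : ∀ {n} → Graph n → List (Fin n) → List (Fin n) → Set
Anticomplete G A B = ∀ {u v} → u LM.∈ A → v LM.∈ B → (u ≢ v) × (adj G u v ≡ false)

SOFree : ℕ → ∀ {n} → Graph n → Subset n → Set
SOFree s G W =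
  ¬ (Σ (Fin s → Cycle G W) λ C →
       ∀ i j → i ≢ j → Anticomplete G (verts (C i)) (verts (C j)))

CycleHitting : ∀ {n} → Graph n → Subset n → Subset n → Set
CycleHitting G W Z = ∀ (C : Cycle G W) → Any (_∈ Z) (verts C)

Plantation : ℕ → ∀ {n} → Graph n → Subset n → Subset n → Set
Plantation s G W Z = (Z ⊆ W) × SOFree s G W × CycleHitting G W Z

Stable : ∀ {n} → Graph n → Subset n → Set
Stable G Z = ∀ {u v} → u ∈ Z → v ∈ Z → adj G u v ≡ false

Dyadic : ℕ → ∀ {n} → Graph n → Subset n → Subset n → Set
Dyadic s G W Z =
  Plantation s G W Z × Stable G Z
  × (∀ v → v ∈ W → v ∉ Z → ∣ N G v ∩ Z ∣ ≤ 2)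

Binary : ∀ {n} → Graph n → Subset n → Subset n → Subset n
Binary G W Z = tabulate (λ v → lookup W v ∧ not (lookup Z v) ∧ (∣ N G v ∩ Z ∣ ≡ᵇ 2))

-- Exploding all vertices of X ⊆ Z (in any order) from (G[W], Z):
-- the remaining vertex set is W minus X and minus the neighbours of X outside Z,
-- and the new cycle-hitting set is Z ∖ X.
explodeV : ∀ {n} → Graph n → Subset n → Subset n → Subset n → Subset n
explodeV G W Z X = W ─ (X ∪ (NSet G X ─ Z))

-- Multigraphs (loops and parallel edges allowed): n vertices, m edges,
-- each edge with an (unordered) pair of ends.

record MGraph (n m : ℕ) : Set where
  field ends : Fin m → Fin n × Fin n
open MGraph public

Joins : ∀ {n m} → MGraph n m → Fin m → Fin n → Fin n → Set
Joins M e u v = (ends M e ≡ (u , v)) ⊎ (ends M e ≡ (v , u))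

-- closed walk: vertex list v0 … vk (with vk = v0), edge list e0 … e(k-1),
-- edge ei joining vi and v(i+1)
MChain : ∀ {n m} → MGraph n m → List (Fin n) → List (Fin m) → Set
MChain M (u ∷ [])    []       = Unit
MChain M (u ∷ v ∷ r) (e ∷ es) = Joins M e u v × MChain M (v ∷ r) es
MChain M _           _        = Empty

-- a cycle in a multigraph: distinct vertices x ∷ xs, distinct edges es,
-- forming a closed walk (length 1 = loop, length 2 = pair of parallel edges)
record MCycle {n m} (M : MGraph n m) : Set where
  constructor mcyc
  field
    start : Fin n
    rest  : List (Fin n)
    edges : List (Fin m)
    uniqV : Unique (start ∷ rest)
    uniqE : Unique edges
    chain : MChain M (start ∷ rest ++ start ∷ []) edges

mverts : ∀ {n m} {M : MGraph n m} → MCycle M → List (Fin n)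
mverts (mcyc x xs _ _ _ _) = x ∷ xs

VDisjoint : ∀ {n} → List (Fin n) → List (Fin n) → Set
VDisjoint A B = ∀ {u} → u LM.∈ A → u LM.∈ B → Empty

ErdosPosaBound : ℕ → ℕ → Set
ErdosPosaBound s φ =
  ∀ n m (M : MGraph n m) →
  ¬ (Σ (Fin s → MCycle M) λ C → ∀ i j → i ≢ j → VDisjoint (mverts (C i)) (mverts (C j))) →
  Σ (Subset n) λ H → (∣ H ∣ ≤ φ) × (∀ (C : MCycle M) → Any (_∈ H) (mverts C))

-- The binary vertices induce a forest, because Z meets every cycle but contains no binary
-- vertex; so they split into two stable classes.  Fix one class P.  In G[Z ∪ P] a vertex of P
-- on a cycle has both of its Z-neighbours on that cycle, so vertex-disjoint cycles of G[Z ∪ P]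
-- are anticomplete and, G being sO-free, the Erdős–Pósa bound applied to G[Z ∪ P] (as a
-- multigraph) gives at most φ vertices meeting all its cycles.  Moving those outside Z to a
-- Z-neighbour yields X ⊆ Z with |X| ≤ φ.  After exploding X, the vertices of Z ∖ X and the
-- surviving vertices of P span a forest in which every survivor keeps its two Z-neighbours, so
-- there are at most |Z| survivors.  Doing this for both classes proves the theorem.

module Submission where

open import Defs hiding (sym)
open import Data.Bool using (Bool; true; false; not; _∧_)
import Data.Bool as Bool
open import Data.Bool.Properties using (∧-conicalˡ; ∧-conicalʳ; T-≡; not-¬)
open import Data.Empty using (⊥; ⊥-elim)
open import Data.Fin using (Fin; zero; suc) renaming (_<_ to _<ᶠ_)
open import Data.Fin.Properties using (any?) renaming (_≟_ to _≟ᶠ_; _<?_ to _<ᶠ?_; <-cmp to <ᶠ-cmp; <-asym to <ᶠ-asym)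
open import Data.Fin.Subset using (Subset; _∈_; _∉_; _⊆_; _∩_; _∪_; _─_; _-_; ∣_∣; ⊤; ⁅_⁆; Nonempty; Empty)
open import Data.Fin.Subset.Properties
open import Data.List
  using (List; []; _∷_; _++_; _∷ʳ_; length; initLast; _∷ʳ′_; filter; cartesianProduct; allFin)
  renaming (lookup to lookupᴸ)
open import Data.List.Membership.Propositional using (find; lose) renaming (_∈_ to _∈ᴸ_; _∉_ to _∉ᴸ_)
open import Data.List.Membership.Propositional.Properties
  using (∈-∃++; ∈-++⁺ˡ; ∈-++⁺ʳ; ∈-++⁻; ∈-lookup; ∈-filter⁺; ∈-filter⁻; ∈-cartesianProduct⁺; ∈-allFin)
open import Data.List.Properties using (++-assoc; length-++)
open import Data.List.Relation.Binary.Subset.Propositional using () renaming (_⊆_ to _⊆ᴸ_)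
open import Data.List.Relation.Unary.All using (All; []; _∷_)
import Data.List.Relation.Unary.All as All
import Data.List.Relation.Unary.All.Properties as All
open import Data.List.Relation.Unary.AllPairs using ([]; _∷_)
open import Data.List.Relation.Unary.Any using (Any; here; there; index)
open import Data.List.Relation.Unary.Any.Properties using (lookup-index)
open import Data.List.Relation.Unary.Unique.Propositional using (Unique)
import Data.List.Relation.Unary.Unique.Propositional.Properties as Unique
open import Data.Nat using (ℕ; zero; suc; _+_; _*_; _≤_; _<_; z≤n; s≤s; _≤?_; _≡ᵇ_)
open import Data.Nat.Properties
open import Data.Product using (Σ; ∃; ∃₂; _×_; _,_; proj₁; proj₂)
open import Data.Sum using (_⊎_; inj₁; inj₂; [_,_]′) renaming (swap to ⊎-swap)
open import Data.Unit using (tt)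
open import Data.Vec using ([]; _∷_; here; there; tabulate; lookup)
open import Data.Vec.Properties using ([]=⇒lookup; lookup⇒[]=; lookup∘tabulate)
open import Function using (_∘_; id; Equivalence)
open import Relation.Binary.Definitions using (tri<; tri≈; tri>)
open import Relation.Binary.PropositionalEquality
open import Relation.Nullary using (¬_; yes; no; Dec)
open import Relation.Nullary.Decidable using (_×-dec_; ¬?)

∣p∪q∣≤∣p∣+∣q∣ : ∀ {n} (p q : Subset n) → ∣ p ∪ q ∣ ≤ ∣ p ∣ + ∣ q ∣
∣p∪q∣≤∣p∣+∣q∣ [] [] = z≤n
∣p∪q∣≤∣p∣+∣q∣ (true ∷ p) (true ∷ q) =
  s≤s (≤-trans (∣p∪q∣≤∣p∣+∣q∣ p q) (≤-trans (n≤1+n _) (≤-reflexive (sym (+-suc _ _)))))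
∣p∪q∣≤∣p∣+∣q∣ (true ∷ p) (false ∷ q) = s≤s (∣p∪q∣≤∣p∣+∣q∣ p q)
∣p∪q∣≤∣p∣+∣q∣ (false ∷ p) (true ∷ q) =
  ≤-trans (s≤s (∣p∪q∣≤∣p∣+∣q∣ p q)) (≤-reflexive (sym (+-suc _ _)))
∣p∪q∣≤∣p∣+∣q∣ (false ∷ p) (false ∷ q) = ∣p∪q∣≤∣p∣+∣q∣ p q

∣p∣≤∣p─q∣+∣p∩q∣ : ∀ {n} (p q : Subset n) → ∣ p ∣ ≤ ∣ p ─ q ∣ + ∣ p ∩ q ∣
∣p∣≤∣p─q∣+∣p∩q∣ [] [] = z≤n
∣p∣≤∣p─q∣+∣p∩q∣ (true ∷ p) (true ∷ q) =
  ≤-trans (s≤s (∣p∣≤∣p─q∣+∣p∩q∣ p q)) (≤-reflexive (sym (+-suc _ _)))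
∣p∣≤∣p─q∣+∣p∩q∣ (true ∷ p) (false ∷ q) = s≤s (∣p∣≤∣p─q∣+∣p∩q∣ p q)
∣p∣≤∣p─q∣+∣p∩q∣ (false ∷ p) (true ∷ q) = ∣p∣≤∣p─q∣+∣p∩q∣ p q
∣p∣≤∣p─q∣+∣p∩q∣ (false ∷ p) (false ∷ q) = ∣p∣≤∣p─q∣+∣p∩q∣ p q

x∈p─q⁻ : ∀ {n} (p q : Subset n) {x} → x ∈ p ─ q → x ∈ p × x ∉ q
x∈p─q⁻ (true ∷ p) (false ∷ q) here = here , λ ()
x∈p─q⁻ (true ∷ p) (true ∷ q) {zero} ()
x∈p─q⁻ (false ∷ p) (true ∷ q) {zero} ()
x∈p─q⁻ (false ∷ p) (false ∷ q) {zero} ()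
x∈p─q⁻ (_ ∷ p) (_ ∷ q) (there x∈p─q) with x∈p─q⁻ p q x∈p─q
... | x∈p , x∉q = there x∈p , λ x∈q → x∉q (drop-there x∈q)

1≤∣p∣⇒Nonempty : ∀ {n} (p : Subset n) → 1 ≤ ∣ p ∣ → Nonempty p
1≤∣p∣⇒Nonempty (true ∷ p) _ = zero , here
1≤∣p∣⇒Nonempty (false ∷ p) 1≤∣p∣ with 1≤∣p∣⇒Nonempty p 1≤∣p∣
... | x , x∈p = suc x , there x∈p

Empty⇒∣p∣≡0 : ∀ {n} {p : Subset n} → Empty p → ∣ p ∣ ≡ 0
Empty⇒∣p∣≡0 {n} p-empty = trans (cong ∣_∣ (Empty-unique p-empty)) (∣⊥∣≡0 n)

Unique⇒length≤∣p∣ : ∀ {n} (p : Subset n) {xs : List (Fin n)} → Unique xs → All (_∈ p) xs → length xs ≤ ∣ p ∣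
Unique⇒length≤∣p∣ p {[]} _ _ = z≤n
Unique⇒length≤∣p∣ p {x ∷ xs} (x∉xs ∷ xs-unique) (x∈p ∷ xs⊆p) =
  ≤-trans (s≤s (Unique⇒length≤∣p∣ (p - x) xs-unique (xs⊆p-x x∉xs xs⊆p))) (x∈p⇒∣p-x∣<∣p∣ x∈p)
  where
  xs⊆p-x : ∀ {ys} → All (x ≢_) ys → All (_∈ p) ys → All (_∈ p - x) ys
  xs⊆p-x [] [] = []
  xs⊆p-x (x≢y ∷ x≢ys) (y∈p ∷ ys⊆p) = x∈p∧x≢y⇒x∈p-y y∈p (x≢y ∘ sym) ∷ xs⊆p-x x≢ys ys⊆p

∣p∣≤1⇒≡ : ∀ {n} (p : Subset n) → ∣ p ∣ ≤ 1 → ∀ {x y} → x ∈ p → y ∈ p → x ≡ y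
∣p∣≤1⇒≡ p ∣p∣≤1 {x} {y} x∈p y∈p with x ≟ᶠ y
... | yes x≡y = x≡y
... | no x≢y =
  ⊥-elim (1+n≰n (≤-trans (Unique⇒length≤∣p∣ p ((x≢y ∷ []) ∷ [] ∷ []) (x∈p ∷ y∈p ∷ [])) ∣p∣≤1))

∣p∣≤2⇒¬three : ∀ {n} (p : Subset n) → ∣ p ∣ ≤ 2 → ∀ {x y z} → x ∈ p → y ∈ p → z ∈ p →
               x ≢ y → x ≢ z → y ≢ z → ⊥
∣p∣≤2⇒¬three p ∣p∣≤2 x∈p y∈p z∈p x≢y x≢z y≢z =
  1+n≰n (≤-trans (Unique⇒length≤∣p∣ p distinct (x∈p ∷ y∈p ∷ z∈p ∷ [])) ∣p∣≤2)
  where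
  distinct = (x≢y ∷ x≢z ∷ []) ∷ (y≢z ∷ []) ∷ [] ∷ []

2≤∣p∣⇒∃≢ : ∀ {n} (p : Subset n) → 2 ≤ ∣ p ∣ → ∀ b → ∃ λ y → y ∈ p × y ≢ b
2≤∣p∣⇒∃≢ p 2≤∣p∣ b with any? (λ y → (y ∈? p) ×-dec ¬? (y ≟ᶠ b))
... | yes witness = witness
... | no none = ⊥-elim (1+n≰n (begin
      2             ≤⟨ 2≤∣p∣ ⟩
      ∣ p ∣         ≤⟨ p⊆q⇒∣p∣≤∣q∣ p⊆⁅b⁆ ⟩
      ∣ ⁅ b ⁆ ∣     ≡⟨ ∣⁅x⁆∣≡1 b ⟩
      1             ∎))
  where
  open ≤-Reasoning
  p⊆⁅b⁆ : p ⊆ ⁅ b ⁆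
  p⊆⁅b⁆ {y} y∈p with y ≟ᶠ b
  ... | yes refl = x∈⁅x⁆ b
  ... | no y≢b = ⊥-elim (none (y , y∈p , y≢b))

∩-monoʳ-⊆ : ∀ {n} (p : Subset n) {q r : Subset n} → q ⊆ r → p ∩ q ⊆ p ∩ r
∩-monoʳ-⊆ p {q} q⊆r x∈ with x∈p∩q⁻ p q x∈
... | x∈p , x∈q = x∈p∩q⁺ (x∈p , q⊆r x∈q)

∪-mono-⊆ : ∀ {n} {p p′ q q′ : Subset n} → p ⊆ p′ → q ⊆ q′ → p ∪ q ⊆ p′ ∪ q′
∪-mono-⊆ {p = p} {q = q} p⊆p′ q⊆q′ x∈ =
  x∈p∪q⁺ ([ inj₁ ∘ p⊆p′ , inj₂ ∘ q⊆q′ ]′ (x∈p∪q⁻ p q x∈))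

∣p∣≤∣[q∩r]∩p∣+∣[q─r]∩p∣ : ∀ {n} {p q : Subset n} (r : Subset n) → p ⊆ q →
                          ∣ p ∣ ≤ ∣ (q ∩ r) ∩ p ∣ + ∣ (q ─ r) ∩ p ∣
∣p∣≤∣[q∩r]∩p∣+∣[q─r]∩p∣ {p = p} {q} r p⊆q =
  ≤-trans (p⊆q⇒∣p∣≤∣q∣ split) (∣p∪q∣≤∣p∣+∣q∣ ((q ∩ r) ∩ p) ((q ─ r) ∩ p))
  where
  split : p ⊆ ((q ∩ r) ∩ p) ∪ ((q ─ r) ∩ p)
  split {x} x∈p with x ∈? r
  ... | yes x∈r = x∈p∪q⁺ (inj₁ (x∈p∩q⁺ (x∈p∩q⁺ (p⊆q x∈p , x∈r) , x∈p)))
  ... | no x∉r = x∈p∪q⁺ (inj₂ (x∈p∩q⁺ (x∈p∧x∉q⇒x∈p─q (p⊆q x∈p) x∉r , x∈p)))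

m≤o⇒n≤o⇒m+n≤2*o : ∀ {m n o} → m ≤ o → n ≤ o → m + n ≤ 2 * o
m≤o⇒n≤o⇒m+n≤2*o {o = o} m≤o n≤o = ≤-trans (+-mono-≤ m≤o n≤o) (≤-reflexive (cong (o +_) (sym (+-identityʳ o))))

image : ∀ {m n} → (Fin m → Fin n) → Subset m → Subset n
image f [] = Data.Fin.Subset.⊥
image f (true ∷ p) = ⁅ f zero ⁆ ∪ image (f ∘ suc) p
image f (false ∷ p) = image (f ∘ suc) p

∣image∣≤∣p∣ : ∀ {m n} (f : Fin m → Fin n) (p : Subset m) → ∣ image f p ∣ ≤ ∣ p ∣
∣image∣≤∣p∣ {n = n} f [] = ≤-reflexive (∣⊥∣≡0 n)
∣image∣≤∣p∣ f (true ∷ p) = begin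
  ∣ ⁅ f zero ⁆ ∪ image (f ∘ suc) p ∣     ≤⟨ ∣p∪q∣≤∣p∣+∣q∣ ⁅ f zero ⁆ _ ⟩
  ∣ ⁅ f zero ⁆ ∣ + ∣ image (f ∘ suc) p ∣  ≡⟨ cong (_+ ∣ image (f ∘ suc) p ∣) (∣⁅x⁆∣≡1 (f zero)) ⟩
  suc ∣ image (f ∘ suc) p ∣               ≤⟨ s≤s (∣image∣≤∣p∣ (f ∘ suc) p) ⟩
  suc ∣ p ∣                               ∎
  where open ≤-Reasoning
∣image∣≤∣p∣ f (false ∷ p) = ∣image∣≤∣p∣ (f ∘ suc) p

x∈p⇒fx∈image : ∀ {m n} (f : Fin m → Fin n) {p : Subset m} {x} → x ∈ p → f x ∈ image f p
x∈p⇒fx∈image f {true ∷ p} here = x∈p∪q⁺ (inj₁ (x∈⁅x⁆ (f zero)))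
x∈p⇒fx∈image f {true ∷ p} (there x∈p) = x∈p∪q⁺ (inj₂ (x∈p⇒fx∈image (f ∘ suc) x∈p))
x∈p⇒fx∈image f {false ∷ p} (there x∈p) = x∈p⇒fx∈image (f ∘ suc) x∈p

∈tabulate⁻ : ∀ {n} (f : Fin n → Bool) {v} → v ∈ tabulate f → f v ≡ true
∈tabulate⁻ f {v} v∈ = trans (sym (lookup∘tabulate f v)) ([]=⇒lookup v∈)

∈tabulate⁺ : ∀ {n} (f : Fin n → Bool) {v} → f v ≡ true → v ∈ tabulate f
∈tabulate⁺ f {v} fv≡true = lookup⇒[]= v (tabulate f) (trans (lookup∘tabulate f v) fv≡true)

∉⇒lookup≡false : ∀ {n} (p : Subset n) {v} → v ∉ p → lookup p v ≡ false
∉⇒lookup≡false p {v} v∉p with lookup p v in eq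
... | true = ⊥-elim (v∉p (lookup⇒[]= v p eq))
... | false = refl

∉tabulate⇒≡false : ∀ {n} (f : Fin n → Bool) {v} → v ∉ tabulate f → f v ≡ false
∉tabulate⇒≡false f {v} v∉ = trans (sym (lookup∘tabulate f v)) (∉⇒lookup≡false (tabulate f) v∉)

Unique-++⁻ˡ : ∀ {a} {A : Set a} (xs : List A) {ys} → Unique (xs ++ ys) → Unique xs
Unique-++⁻ˡ [] _ = []
Unique-++⁻ˡ (x ∷ xs) (x∉ ∷ unique) = All.++⁻ˡ xs x∉ ∷ Unique-++⁻ˡ xs unique

Unique-∷ʳ⁺ : ∀ {a} {A : Set a} {xs : List A} {x} → Unique xs → All (x ≢_) xs → Unique (xs ∷ʳ x)
Unique-∷ʳ⁺ unique x∉xs = Unique.++⁺ unique ([] ∷ []) λ { (v∈xs , here refl) → All.lookup x∉xs v∈xs refl }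

Unique⇒length≤n : ∀ {n} {xs : List (Fin n)} → Unique xs → length xs ≤ n
Unique⇒length≤n {n} {xs} unique =
  ≤-trans (Unique⇒length≤∣p∣ ⊤ unique (All.universal (λ _ → ∈⊤) xs)) (≤-reflexive (∣⊤∣≡n n))

x∈xs∷ʳx : ∀ {a} {A : Set a} (xs : List A) {x} → x ∈ᴸ xs ∷ʳ x
x∈xs∷ʳx xs = ∈-++⁺ʳ xs (here refl)

Unique-++⇒≢ : ∀ {a} {A : Set a} (xs : List A) {ys x y} → Unique (xs ++ ys) → x ∈ᴸ xs → y ∈ᴸ ys → x ≢ y
Unique-++⇒≢ (_ ∷ xs) (x∉ ∷ _) (here refl) y∈ys = All.lookup x∉ (∈-++⁺ʳ xs y∈ys)
Unique-++⇒≢ (_ ∷ xs) (_ ∷ unique) (there x∈xs) y∈ys = Unique-++⇒≢ xs unique x∈xs y∈ys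

Unique⇒lookup-injective : ∀ {a} {A : Set a} {xs : List A} → Unique xs → ∀ i j → lookupᴸ xs i ≡ lookupᴸ xs j → i ≡ j
Unique⇒lookup-injective {xs = _ ∷ _} _ zero zero _ = refl
Unique⇒lookup-injective {xs = _ ∷ _} (x∉ ∷ _) zero (suc j) eq = ⊥-elim (All.lookup x∉ (∈-lookup j) eq)
Unique⇒lookup-injective {xs = _ ∷ _} (x∉ ∷ _) (suc i) zero eq = ⊥-elim (All.lookup x∉ (∈-lookup i) (sym eq))
Unique⇒lookup-injective {xs = _ ∷ _} (_ ∷ unique) (suc i) (suc j) eq = cong suc (Unique⇒lookup-injective unique i j eq)

module _ {n} (G : Graph n) where

  ∈N⁻ : ∀ {v y} → y ∈ N G v → adj G v y ≡ true
  ∈N⁻ = ∈tabulate⁻ (adj G _)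

  ∈N⁺ : ∀ {v y} → adj G v y ≡ true → y ∈ N G v
  ∈N⁺ = ∈tabulate⁺ (adj G _)

  adj⇒≢ : ∀ {u v} → adj G u v ≡ true → u ≢ v
  adj⇒≢ {u} u~v refl with trans (sym u~v) (irrefl G u)
  ... | ()

  ∈NSet⁺ : ∀ {X v x} → x ∈ X → adj G v x ≡ true → v ∈ NSet G X
  ∈NSet⁺ {X} {v} x∈X v~x =
    ∈tabulate⁺ _ (nonzero (≤-trans (s≤s z≤n) (x∈p⇒∣p-x∣<∣p∣ (x∈p∩q⁺ (∈N⁺ v~x , x∈X)))))
    where
    nonzero : ∀ {k} → 1 ≤ k → not (k ≡ᵇ 0) ≡ true
    nonzero {suc k} _ = refl

  N∩p⊆N∩[p-w] : ∀ {p s w} → s ∉ N G w → N G s ∩ p ⊆ N G s ∩ (p - w)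
  N∩p⊆N∩[p-w] {p} {s} {w} s∉N x∈ with x∈p∩q⁻ (N G s) p x∈
  ... | x∈N , x∈p =
    x∈p∩q⁺ (x∈N , x∈p∧x≢y⇒x∈p-y x∈p λ { refl → s∉N (∈N⁺ (trans (Graph.sym G w s) (∈N⁻ x∈N))) })

  ∈Binary⁻ : ∀ {W Z v} → v ∈ Binary G W Z → v ∈ W × v ∉ Z × ∣ N G v ∩ Z ∣ ≡ 2
  ∈Binary⁻ {W} {Z} {v} v∈B =
    lookup⇒[]= v W (∧-conicalˡ _ _ v∈B′) , v∉Z , ≡ᵇ⇒≡ _ 2 (Equivalence.from T-≡ (∧-conicalʳ _ _ rest))
    where
    v∈B′ : lookup W v ∧ not (lookup Z v) ∧ (∣ N G v ∩ Z ∣ ≡ᵇ 2) ≡ true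
    v∈B′ = ∈tabulate⁻ _ v∈B
    rest : not (lookup Z v) ∧ (∣ N G v ∩ Z ∣ ≡ᵇ 2) ≡ true
    rest = ∧-conicalʳ (lookup W v) _ v∈B′
    v∉Z : v ∉ Z
    v∉Z v∈Z with trans (sym (cong not ([]=⇒lookup v∈Z))) (∧-conicalˡ _ _ rest)
    ... | ()

  ∈Binary⁺ : ∀ {W Z v} → v ∈ W → v ∉ Z → ∣ N G v ∩ Z ∣ ≡ 2 → v ∈ Binary G W Z
  ∈Binary⁺ {W} {Z} {v} v∈W v∉Z deg≡2 = ∈tabulate⁺ _ (begin
    lookup W v ∧ not (lookup Z v) ∧ (∣ N G v ∩ Z ∣ ≡ᵇ 2)
      ≡⟨ cong₂ (λ a b → a ∧ not b ∧ (∣ N G v ∩ Z ∣ ≡ᵇ 2)) ([]=⇒lookup v∈W) (∉⇒lookup≡false Z v∉Z) ⟩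
    (∣ N G v ∩ Z ∣ ≡ᵇ 2)
      ≡⟨ Equivalence.to T-≡ (≡⇒≡ᵇ _ 2 deg≡2) ⟩
    true ∎)
    where open ≡-Reasoning

Binary⊆W─Z : ∀ {n} (G : Graph n) {W Z : Subset n} → Binary G W Z ⊆ W ─ Z
Binary⊆W─Z G v∈B = let v∈W , v∉Z , _ = ∈Binary⁻ G v∈B in x∈p∧x∉q⇒x∈p─q v∈W v∉Z

Stable⇒¬adj : ∀ {n} (G : Graph n) {S : Subset n} → Stable G S → ∀ {u v} → u ∈ S → v ∈ S → adj G u v ≢ true
Stable⇒¬adj G S-stable u∈S v∈S u~v with trans (sym u~v) (S-stable u∈S v∈S)
... | ()

¬adj⇒Stable : ∀ {n} (G : Graph n) {S : Subset n} → (∀ {u v} → u ∈ S → v ∈ S → adj G u v ≢ true) → Stable G S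
¬adj⇒Stable G ¬adj {u} {v} u∈S v∈S with adj G u v in u~v
... | false = refl
... | true = ⊥-elim (¬adj u∈S v∈S u~v)

Cycle-mono : ∀ {n} {G : Graph n} {W W′ : Subset n} → W ⊆ W′ → Cycle G W → Cycle G W′
Cycle-mono W⊆W′ (cyc x xs (long , unique , x∷xs⊆W , chain)) =
  cyc x xs (long , unique , All.map W⊆W′ x∷xs⊆W , chain)

verts⊆ : ∀ {n} {G : Graph n} {W : Subset n} (C : Cycle G W) → All (_∈ W) (verts C)
verts⊆ (cyc _ _ (_ , _ , x∷xs⊆W , _)) = x∷xs⊆W

ChainAdj-++⁻ˡ : ∀ {n} {G : Graph n} ws {vs} → ChainAdj G (ws ++ vs) → ChainAdj G ws
ChainAdj-++⁻ˡ [] _ = tt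
ChainAdj-++⁻ˡ (w ∷ []) _ = tt
ChainAdj-++⁻ˡ (w ∷ w′ ∷ ws) (w~w′ , chain) = w~w′ , ChainAdj-++⁻ˡ (w′ ∷ ws) chain

ChainAdj-∷ʳ⁺ : ∀ {n} {G : Graph n} ws {u v} → ChainAdj G (ws ∷ʳ u) → adj G u v ≡ true → ChainAdj G (ws ∷ʳ u ∷ʳ v)
ChainAdj-∷ʳ⁺ [] _ u~v = u~v , tt
ChainAdj-∷ʳ⁺ (w ∷ []) (w~u , _) u~v = w~u , u~v , tt
ChainAdj-∷ʳ⁺ (w ∷ w′ ∷ ws) (w~w′ , chain) u~v = w~w′ , ChainAdj-∷ʳ⁺ (w′ ∷ ws) chain u~v

ChainAdj-link : ∀ {n} {G : Graph n} ws {u v vs} → ChainAdj G (ws ++ u ∷ v ∷ vs) → adj G u v ≡ true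
ChainAdj-link [] (u~v , _) = u~v
ChainAdj-link (w ∷ []) (_ , chain) = ChainAdj-link [] chain
ChainAdj-link (w ∷ w′ ∷ ws) (_ , chain) = ChainAdj-link (w′ ∷ ws) chain

ChainAdj-∷ʳ-link : ∀ {n} {G : Graph n} ws {u v vs} → ChainAdj G ((ws ∷ʳ u) ++ v ∷ vs) → adj G u v ≡ true
ChainAdj-∷ʳ-link [] (u~v , _) = u~v
ChainAdj-∷ʳ-link (w ∷ []) (_ , chain) = ChainAdj-∷ʳ-link [] chain
ChainAdj-∷ʳ-link (w ∷ w′ ∷ ws) (_ , chain) = ChainAdj-∷ʳ-link (w′ ∷ ws) chain

cycle-neighbours : ∀ {n} {G : Graph n} {W : Subset n} (C : Cycle G W) {v} → v ∈ᴸ verts C →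
                   ∃₂ λ p q → p ≢ q × adj G v p ≡ true × adj G v q ≡ true × p ∈ᴸ verts C × q ∈ᴸ verts C
cycle-neighbours {G = G} (cyc x (x₁ ∷ ys) (long , _ ∷ (x₁∉ ∷ _) , _ , chain)) (here refl) with initLast ys
... | [] = ⊥-elim (<-irrefl refl long)
... | ys′ ∷ʳ′ l =
  x₁ , l , All.lookup x₁∉ (x∈xs∷ʳx ys′) ,
  proj₁ chain , trans (Graph.sym G x l) (ChainAdj-∷ʳ-link (x ∷ x₁ ∷ ys′) chain) ,
  there (here refl) , there (there (x∈xs∷ʳx ys′))
cycle-neighbours {G = G} (cyc x xs (long , x∉ ∷ unique , _ , chain)) {v} (there v∈xs) with ∈-∃++ v∈xs
... | pre , post , refl with initLast pre | post
...   | [] | [] = ⊥-elim (<-irrefl refl long)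
...   | [] | q ∷ post′ =
  x , q , All.lookup x∉ (there (here refl)) , trans (Graph.sym G v x) (proj₁ chain) ,
  ChainAdj-link (x ∷ []) (ChainAdj-++⁻ˡ (x ∷ v ∷ q ∷ post′) chain) , here refl , there (there (here refl))
...   | pre′ ∷ʳ′ p | [] =
  p , x , (λ p≡x → All.lookup x∉ (∈-++⁺ˡ (x∈xs∷ʳx pre′)) (sym p≡x)) ,
  trans (Graph.sym G v p) (ChainAdj-∷ʳ-link (x ∷ pre′) (ChainAdj-++⁻ˡ ((x ∷ pre′ ∷ʳ p) ++ v ∷ []) chain)) ,
  ChainAdj-∷ʳ-link (x ∷ pre′ ∷ʳ p) chain , there (∈-++⁺ˡ (x∈xs∷ʳx pre′)) , here refl
...   | pre′ ∷ʳ′ p | q ∷ post′ =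
  p , q , Unique-++⇒≢ (pre′ ∷ʳ p) unique (x∈xs∷ʳx pre′) (there (here refl)) ,
  trans (Graph.sym G v p) (ChainAdj-∷ʳ-link (x ∷ pre′) (ChainAdj-++⁻ˡ ((x ∷ pre′ ∷ʳ p) ++ v ∷ q ∷ post′) chain)) ,
  ChainAdj-link (x ∷ pre′ ∷ʳ p) (ChainAdj-++⁻ˡ ((x ∷ pre′ ∷ʳ p) ++ v ∷ q ∷ post′) chain) ,
  there (∈-++⁺ˡ (x∈xs∷ʳx pre′)) , there (∈-++⁺ʳ (pre′ ∷ʳ p) (there (here refl)))

SOFree-mono : ∀ {s n} {G : Graph n} {W W′ : Subset n} → W′ ⊆ W → SOFree s G W → SOFree s G W′
SOFree-mono W′⊆W sO-free (C , anticomplete) = sO-free ((Cycle-mono W′⊆W ∘ C) , anticomplete)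

Acyclic : ∀ {n} → Graph n → Subset n → Set
Acyclic G W = ¬ Cycle G W

Acyclic-mono : ∀ {n} {G : Graph n} {W W′ : Subset n} → W′ ⊆ W → Acyclic G W → Acyclic G W′
Acyclic-mono W′⊆W acyclic = acyclic ∘ Cycle-mono W′⊆W

CycleHitting⇒Acyclic : ∀ {n} {G : Graph n} {W Z : Subset n} → CycleHitting G W Z → Acyclic G (W ─ Z)
CycleHitting⇒Acyclic {W = W} {Z} hitting C with find (hitting (Cycle-mono (p─q⊆p W Z) C))
... | v , v∈C , v∈Z = proj₂ (x∈p─q⁻ W Z (All.lookup (verts⊆ C) v∈C)) v∈Z

-- Exploding

module _ {n} (G : Graph n) {W Z X : Subset n} where

  explode⊆ : explodeV G W Z X ⊆ W
  explode⊆ = p─q⊆p W _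

  explode-∉ : ∀ {v} → v ∈ explodeV G W Z X → v ∉ X ∪ (NSet G X ─ Z)
  explode-∉ v∈ = proj₂ (x∈p─q⁻ W _ v∈)

  explode-∉X : ∀ {v} → v ∈ explodeV G W Z X → v ∉ X
  explode-∉X v∈ v∈X = explode-∉ v∈ (x∈p∪q⁺ (inj₁ v∈X))

  explode-no-edge-to-X : ∀ {v x} → v ∈ explodeV G W Z X → v ∉ Z → x ∈ X → adj G v x ≡ true → ⊥
  explode-no-edge-to-X v∈ v∉Z x∈X v~x =
    explode-∉ v∈ (x∈p∪q⁺ (inj₂ (x∈p∧x∉q⇒x∈p─q (∈NSet⁺ G x∈X v~x) v∉Z)))

  explode-∉Z : ∀ {v} → v ∈ explodeV G W Z X → v ∉ Z ─ X → v ∉ Z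
  explode-∉Z v∈ v∉Z─X v∈Z = v∉Z─X (x∈p∧x∉q⇒x∈p─q v∈Z (explode-∉X v∈))

  Z─X⊆explode : Z ⊆ W → Z ─ X ⊆ explodeV G W Z X
  Z─X⊆explode Z⊆W z∈ with x∈p─q⁻ Z X z∈
  ... | z∈Z , z∉X = x∈p∧x∉q⇒x∈p─q (Z⊆W z∈Z) λ z∈X∪ →
    [ z∉X , (λ z∈N─Z → proj₂ (x∈p─q⁻ _ Z z∈N─Z) z∈Z) ]′ (x∈p∪q⁻ X _ z∈X∪)

  explode-N∩Z : ∀ {v} → v ∈ explodeV G W Z X → v ∉ Z → N G v ∩ Z ⊆ N G v ∩ (Z ─ X)
  explode-N∩Z v∈ v∉Z x∈ with x∈p∩q⁻ (N G _) Z x∈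
  ... | x∈N , x∈Z =
    x∈p∩q⁺ (x∈N , x∈p∧x∉q⇒x∈p─q x∈Z λ x∈X → explode-no-edge-to-X v∈ v∉Z x∈X (∈N⁻ G x∈N))

  explode-Dyadic : ∀ {s} → Dyadic s G W Z → Dyadic s G (explodeV G W Z X) (Z ─ X)
  explode-Dyadic ((Z⊆W , sO-free , hitting) , Z-stable , degree≤2) =
    (Z─X⊆explode Z⊆W , SOFree-mono explode⊆ sO-free , hitting′) , Z─X-stable , degree′≤2
    where
    hitting′ : CycleHitting G (explodeV G W Z X) (Z ─ X)
    hitting′ C with find (hitting (Cycle-mono explode⊆ C))
    ... | v , v∈C , v∈Z = lose v∈C (x∈p∧x∉q⇒x∈p─q v∈Z (explode-∉X (All.lookup (verts⊆ C) v∈C)))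
    Z─X-stable : Stable G (Z ─ X)
    Z─X-stable u∈ v∈ = Z-stable (proj₁ (x∈p─q⁻ Z X u∈)) (proj₁ (x∈p─q⁻ Z X v∈))
    degree′≤2 : ∀ v → v ∈ explodeV G W Z X → v ∉ Z ─ X → ∣ N G v ∩ (Z ─ X) ∣ ≤ 2
    degree′≤2 v v∈ v∉Z─X =
      ≤-trans (p⊆q⇒∣p∣≤∣q∣ (∩-monoʳ-⊆ (N G v) (p─q⊆p Z X)))
              (degree≤2 v (explode⊆ v∈) (explode-∉Z v∈ v∉Z─X))

  Binary-explode⊆ : Binary G (explodeV G W Z X) (Z ─ X) ⊆ Binary G W Z
  Binary-explode⊆ {v} v∈B′ with ∈Binary⁻ G v∈B′
  ... | v∈W′ , v∉Z─X , degree′≡2 = ∈Binary⁺ G (explode⊆ v∈W′) v∉Z (≤-antisym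
        (≤-trans (p⊆q⇒∣p∣≤∣q∣ (explode-N∩Z v∈W′ v∉Z)) (≤-reflexive degree′≡2))
        (≤-trans (≤-reflexive (sym degree′≡2)) (p⊆q⇒∣p∣≤∣q∣ (∩-monoʳ-⊆ (N G v) (p─q⊆p Z X)))))
    where
    v∉Z = explode-∉Z v∈W′ v∉Z─X

-- Forests

module _ {n} (G : Graph n) {W : Subset n} (δ≥2 : ∀ {v} → v ∈ W → 2 ≤ ∣ N G v ∩ W ∣) where

  open import Data.List.Membership.DecPropositional (_≟ᶠ_ {n}) using () renaming (_∈?_ to _∈ᴸ?_)

  private
    IsPath : List (Fin n) → Set
    IsPath ws = Unique ws × All (_∈ W) ws × ChainAdj G ws

    IsPath-++⁻ˡ : ∀ ws {vs} → IsPath (ws ++ vs) → IsPath ws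
    IsPath-++⁻ˡ ws (unique , ⊆W , chain) = Unique-++⁻ˡ ws unique , All.++⁻ˡ ws ⊆W , ChainAdj-++⁻ˡ ws chain

    previous : Fin n → List (Fin n) → Fin n
    previous a [] = a
    previous a (b ∷ _) = b

    close : ∀ a rest {y} → IsPath (a ∷ rest) → adj G a y ≡ true → y ≢ previous a rest → y ∈ᴸ rest → Cycle G W
    close a rest {y} path a~y y≢previous y∈rest with ∈-∃++ y∈rest
    ... | [] , post , refl = ⊥-elim (y≢previous refl)
    ... | b ∷ pre , post , refl with IsPath-++⁻ˡ (a ∷ b ∷ pre ∷ʳ y) (subst IsPath reassoc path)
      where
      reassoc : a ∷ b ∷ pre ++ y ∷ post ≡ (a ∷ b ∷ pre ∷ʳ y) ++ post
      reassoc = cong (λ l → a ∷ b ∷ l) (sym (++-assoc pre (y ∷ []) post))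
    ... | unique , ⊆W , chain =
      cyc a (b ∷ pre ∷ʳ y) (long , unique , ⊆W , ChainAdj-∷ʳ⁺ (a ∷ b ∷ pre) chain (trans (Graph.sym G y a) a~y))
      where
      long : 2 ≤ length (b ∷ pre ∷ʳ y)
      long = s≤s (≤-trans (m≤n+m 1 (length pre)) (≤-reflexive (sym (length-++ pre))))

    -- Paths are kept newest vertex first; a simple path has at most n vertices, so the fuel
    -- never runs out.
    grow : ∀ fuel a rest → IsPath (a ∷ rest) → n < fuel + length (a ∷ rest) → Cycle G W
    grow zero a rest (unique , _) n<length = ⊥-elim (<⇒≱ n<length (Unique⇒length≤n unique))
    grow (suc fuel) a rest path@(unique , a∈W ∷ rest⊆W , chain) n<length
      with 2≤∣p∣⇒∃≢ (N G a ∩ W) (δ≥2 a∈W) (previous a rest)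
    ... | y , y∈N∩W , y≢previous with x∈p∩q⁻ (N G a) W y∈N∩W | y ∈ᴸ? rest
    ...   | y∈N , _ | yes y∈rest = close a rest path (∈N⁻ G y∈N) y≢previous y∈rest
    ...   | y∈N , y∈W | no y∉rest =
      grow fuel y (a ∷ rest) (y∉a∷rest ∷ unique , y∈W ∷ a∈W ∷ rest⊆W , trans (Graph.sym G y a) (∈N⁻ G y∈N) , chain)
           (≤-trans n<length (≤-reflexive (sym (+-suc fuel _))))
      where
      y∉a∷rest : All (y ≢_) (a ∷ rest)
      y∉a∷rest = (adj⇒≢ G (∈N⁻ G y∈N) ∘ sym) ∷ All.¬Any⇒All¬ rest y∉rest

  δ≥2⇒Cycle : ∀ {v} → v ∈ W → Cycle G W
  δ≥2⇒Cycle {v} v∈W = grow n v [] ([] ∷ [] , v∈W ∷ [] , tt) (≤-reflexive (+-comm 1 n))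

Acyclic⇒leaf : ∀ {n} (G : Graph n) {W : Subset n} → Acyclic G W → Nonempty W → ∃ λ w → w ∈ W × ∣ N G w ∩ W ∣ ≤ 1
Acyclic⇒leaf G {W} acyclic (v , v∈W) with any? (λ w → (w ∈? W) ×-dec (∣ N G w ∩ W ∣ ≤? 1))
... | yes leaf = leaf
... | no no-leaf = ⊥-elim (acyclic (δ≥2⇒Cycle G δ≥2 v∈W))
  where
  δ≥2 : ∀ {w} → w ∈ W → 2 ≤ ∣ N G w ∩ W ∣
  δ≥2 {w} w∈W = ≰⇒> λ deg≤1 → no-leaf (w , w∈W , deg≤1)

ProperColouring : ∀ {n} → Graph n → Subset n → (Fin n → Bool) → Set
ProperColouring G W c = ∀ {u v} → u ∈ W → v ∈ W → adj G u v ≡ true → c u ≢ c v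

module _ {n} (G : Graph n) where

  private
    recolour : (Fin n → Bool) → Fin n → Bool → Fin n → Bool
    recolour c w b x with x ≟ᶠ w
    ... | yes _ = b
    ... | no _ = c x

    ∣N∩W∣≤1⇒neighbours≡ : ∀ {W w} → ∣ N G w ∩ W ∣ ≤ 1 →
                          ∃ λ u → ∀ {y} → y ∈ W → adj G w y ≡ true → y ≡ u
    ∣N∩W∣≤1⇒neighbours≡ {W} {w} deg≤1 with nonempty? (N G w ∩ W)
    ... | yes (u , u∈) = u , λ y∈W w~y → ∣p∣≤1⇒≡ (N G w ∩ W) deg≤1 (x∈p∩q⁺ (∈N⁺ G w~y , y∈W)) u∈
    ... | no none = w , λ y∈W w~y → ⊥-elim (none (_ , x∈p∩q⁺ (∈N⁺ G w~y , y∈W)))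

    recolour-proper : ∀ {W w u c} → ProperColouring G (W - w) c → (∀ {y} → y ∈ W → adj G w y ≡ true → y ≡ u) →
                      ProperColouring G W (recolour c w (not (c u)))
    recolour-proper {W} {w} {u} {c} c-proper neighbours≡u {x} {y} x∈W y∈W x~y with x ≟ᶠ w | y ≟ᶠ w
    ... | yes refl | yes refl = λ _ → adj⇒≢ G x~y refl
    ... | yes refl | no _ = λ eq → not-¬ refl (sym (trans eq (cong c (neighbours≡u y∈W x~y))))
    ... | no _ | yes refl = λ eq → not-¬ refl (trans (sym (cong c (neighbours≡u x∈W (trans (Graph.sym G y x) x~y)))) eq)
    ... | no x≢w | no y≢w = c-proper (x∈p∧x≢y⇒x∈p-y x∈W x≢w) (x∈p∧x≢y⇒x∈p-y y∈W y≢w) x~y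

    colour : ∀ k {W} → ∣ W ∣ ≤ k → Acyclic G W → Σ (Fin n → Bool) (ProperColouring G W)
    colour k {W} ∣W∣≤k acyclic with nonempty? W
    ... | no empty = (λ _ → true) , λ u∈W → ⊥-elim (empty (_ , u∈W))
    ... | yes nonempty with Acyclic⇒leaf G acyclic nonempty
    ...   | w , w∈W , deg≤1 with k | ≤-trans (x∈p⇒∣p-x∣<∣p∣ w∈W) ∣W∣≤k
    ...     | zero | ()
    ...     | suc k | s≤s ∣W-w∣≤k
            with colour k ∣W-w∣≤k (Acyclic-mono (p─q⊆p W ⁅ w ⁆) acyclic) | ∣N∩W∣≤1⇒neighbours≡ deg≤1
    ...       | c , c-proper | u , neighbours≡u = recolour c w (not (c u)) , recolour-proper c-proper neighbours≡u

  Acyclic⇒ProperColouring : ∀ {W} → Acyclic G W → Σ (Fin n → Bool) (ProperColouring G W)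
  Acyclic⇒ProperColouring {W} = colour ∣ W ∣ ≤-refl

  Acyclic⇒∣S∣≤∣A∣ : ∀ {A S : Subset n} → Acyclic G (A ∪ S) → (∀ {s} → s ∈ S → 2 ≤ ∣ N G s ∩ A ∣) →
                   ∣ S ∣ ≤ ∣ A ∣
  Acyclic⇒∣S∣≤∣A∣ {A} = count ∣ A ∣ ≤-refl
    where
    -- A leaf w of G[A ∪ S] lies in A and has at most one neighbour in S; remove w and it.
    count : ∀ k {A S} → ∣ A ∣ ≤ k → Acyclic G (A ∪ S) → (∀ {s} → s ∈ S → 2 ≤ ∣ N G s ∩ A ∣) →
            ∣ S ∣ ≤ ∣ A ∣
    count k {A} {S} ∣A∣≤k acyclic δS≥2 with nonempty? A
    ... | no A-empty = ≤-trans (≤-reflexive (Empty⇒∣p∣≡0 S-empty)) z≤n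
      where
      S-empty : Empty S
      S-empty (s , s∈S) with 1≤∣p∣⇒Nonempty (N G s ∩ A) (≤-trans (s≤s z≤n) (δS≥2 s∈S))
      ... | a , a∈ = A-empty (a , proj₂ (x∈p∩q⁻ (N G s) A a∈))
    ... | yes (a , a∈A) with Acyclic⇒leaf G acyclic (a , x∈p∪q⁺ (inj₁ a∈A))
    ...   | w , w∈A∪S , deg≤1 with x∈p∪q⁻ A S w∈A∪S
    ...     | inj₂ w∈S =
      ⊥-elim (1+n≰n (≤-trans (δS≥2 w∈S) (≤-trans (p⊆q⇒∣p∣≤∣q∣ (∩-monoʳ-⊆ (N G w) (p⊆p∪q S))) deg≤1)))
    ...     | inj₁ w∈A with k | ≤-trans (x∈p⇒∣p-x∣<∣p∣ w∈A) ∣A∣≤k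
    ...       | zero | ()
    ...       | suc k | s≤s ∣A-w∣≤k = begin
      ∣ S ∣                           ≤⟨ ∣p∣≤∣p─q∣+∣p∩q∣ S (N G w) ⟩
      ∣ S ─ N G w ∣ + ∣ S ∩ N G w ∣   ≤⟨ +-mono-≤ S′≤A′ S∩N≤1 ⟩
      ∣ A - w ∣ + 1                   ≡⟨ +-comm _ 1 ⟩
      suc ∣ A - w ∣                   ≤⟨ x∈p⇒∣p-x∣<∣p∣ w∈A ⟩
      ∣ A ∣                           ∎
      where
      open ≤-Reasoning
      S′≤A′ : ∣ S ─ N G w ∣ ≤ ∣ A - w ∣
      S′≤A′ = count k ∣A-w∣≤k (Acyclic-mono (∪-mono-⊆ (p─q⊆p A _) (p─q⊆p S _)) acyclic) δS′≥2
        where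
        δS′≥2 : ∀ {s} → s ∈ S ─ N G w → 2 ≤ ∣ N G s ∩ (A - w) ∣
        δS′≥2 s∈ = let s∈S , s∉N = x∈p─q⁻ S (N G w) s∈ in
          ≤-trans (δS≥2 s∈S) (p⊆q⇒∣p∣≤∣q∣ (N∩p⊆N∩[p-w] G s∉N))
      S∩N≤1 : ∣ S ∩ N G w ∣ ≤ 1
      S∩N≤1 = begin
        ∣ S ∩ N G w ∣        ≡⟨ cong ∣_∣ (∩-comm S (N G w)) ⟩
        ∣ N G w ∩ S ∣        ≤⟨ p⊆q⇒∣p∣≤∣q∣ (∩-monoʳ-⊆ (N G w) (q⊆p∪q A S)) ⟩
        ∣ N G w ∩ (A ∪ S) ∣  ≤⟨ deg≤1 ⟩
        1                    ∎

module _ {n} (G : Graph n) {W : Subset n} {c : Fin n → Bool} (c-proper : ProperColouring G W c) where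

  colour-class-stable : Stable G (W ∩ tabulate c)
  colour-class-stable = ¬adj⇒Stable G λ u∈ v∈ u~v →
    let u∈W , u∈R = x∈p∩q⁻ W _ u∈ ; v∈W , v∈R = x∈p∩q⁻ W _ v∈ in
    c-proper u∈W v∈W u~v (trans (∈tabulate⁻ c u∈R) (sym (∈tabulate⁻ c v∈R)))

  colour-class-stable′ : Stable G (W ─ tabulate c)
  colour-class-stable′ = ¬adj⇒Stable G λ u∈ v∈ u~v →
    let u∈W , u∉R = x∈p─q⁻ W _ u∈ ; v∈W , v∉R = x∈p─q⁻ W _ v∈ in
    c-proper u∈W v∈W u~v (trans (∉tabulate⇒≡false c u∉R) (sym (∉tabulate⇒≡false c v∉R)))

module _ {n m} (M : MGraph n m) where

  endpoints : Fin m → List (Fin n)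
  endpoints e = proj₁ (ends M e) ∷ proj₂ (ends M e) ∷ []

  private
    pairList : Fin n × Fin n → List (Fin n)
    pairList (u , v) = u ∷ v ∷ []

    swap∈ : ∀ {u v w : Fin n} → w ∈ᴸ u ∷ v ∷ [] → w ∈ᴸ v ∷ u ∷ []
    swap∈ (here w≡u) = there (here w≡u)
    swap∈ (there (here w≡v)) = here w≡v

  Joins⇒endpoints⊆ : ∀ {e u v} → Joins M e u v → endpoints e ⊆ᴸ u ∷ v ∷ []
  Joins⇒endpoints⊆ (inj₁ eq) w∈ = subst (λ p → _ ∈ᴸ pairList p) eq w∈
  Joins⇒endpoints⊆ (inj₂ eq) w∈ = swap∈ (subst (λ p → _ ∈ᴸ pairList p) eq w∈)

  Joins⇒⊆endpoints : ∀ {e u v} → Joins M e u v → u ∷ v ∷ [] ⊆ᴸ endpoints e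
  Joins⇒⊆endpoints (inj₁ eq) w∈ = subst (λ p → _ ∈ᴸ pairList p) (sym eq) w∈
  Joins⇒⊆endpoints (inj₂ eq) w∈ = subst (λ p → _ ∈ᴸ pairList p) (sym eq) (swap∈ w∈)

  MChain⇒endpoints⊆ : ∀ {ws es} → MChain M ws es → All (λ e → endpoints e ⊆ᴸ ws) es
  MChain⇒endpoints⊆ {_ ∷ []} {[]} _ = []
  MChain⇒endpoints⊆ {_ ∷ _ ∷ _} {_ ∷ _} (joins , chain) =
    (λ w∈ → ∈-++⁺ˡ (Joins⇒endpoints⊆ joins w∈)) ∷
    All.map (λ ⊆ws {_} w∈ → there (⊆ws w∈)) (MChain⇒endpoints⊆ chain)
  MChain⇒endpoints⊆ {[]} ()
  MChain⇒endpoints⊆ {_ ∷ []} {_ ∷ _} ()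
  MChain⇒endpoints⊆ {_ ∷ _ ∷ _} {[]} ()

  MChain-Unique : ∀ {ws es} → Unique ws → MChain M ws es → Unique es
  MChain-Unique {_ ∷ []} {[]} _ _ = []
  MChain-Unique {u ∷ _ ∷ _} {e ∷ es} (u∉ ∷ unique) (joins , chain) =
    All.¬Any⇒All¬ es e∉es ∷ MChain-Unique unique chain
    where
    e∉es : e ∉ᴸ es
    e∉es e∈es = All.lookup u∉ (All.lookup (MChain⇒endpoints⊆ chain) e∈es (Joins⇒⊆endpoints joins (here refl))) refl
  MChain-Unique {[]} _ ()
  MChain-Unique {_ ∷ []} {_ ∷ _} _ ()
  MChain-Unique {_ ∷ _ ∷ _} {[]} _ ()

  -- The edges after the first form a path from x₁ to x, so they are distinct; the only one of
  -- them at x₁ is the first of them, which misses x, so none of them is the first edge.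
  closed-MChain-Unique : ∀ {x xs es} → Unique (x ∷ xs) → 2 ≤ length xs → MChain M (x ∷ xs ++ x ∷ []) es → Unique es
  closed-MChain-Unique {x} {x₁ ∷ y ∷ ys} {e ∷ e₁ ∷ es} unique@(x∉ ∷ x₁∉ ∷ _) _ (joins , chain@(joins₁ , chain₁)) =
    All.¬Any⇒All¬ (e₁ ∷ es) e∉ ∷ MChain-Unique (Unique-∷ʳ⁺ (drop-head unique) x∉) chain
    where
    drop-head : ∀ {a as} → Unique (a ∷ as) → Unique as
    drop-head (_ ∷ unique) = unique
    e∉ : e ∉ᴸ e₁ ∷ es
    e∉ (here refl) with Joins⇒endpoints⊆ joins₁ (Joins⇒⊆endpoints joins (here refl))
    ... | x∈ = All.lookup x∉ (∈-++⁺ˡ x∈) refl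
    e∉ (there e∈es)
      with ∈-++⁻ (y ∷ ys) (All.lookup (MChain⇒endpoints⊆ chain₁) e∈es (Joins⇒⊆endpoints joins (there (here refl))))
    ... | inj₁ x₁∈ = All.lookup x₁∉ x₁∈ refl
    ... | inj₂ (here x₁≡x) = All.lookup x∉ (here (sym x₁≡x)) refl
  closed-MChain-Unique {xs = []} _ ()
  closed-MChain-Unique {xs = _ ∷ []} _ (s≤s ())

-- A graph as a multigraph

module _ {n} (G : Graph n) (W : Subset n) where

  -- Each edge uv of G[W] is listed once, as the pair (u , v) with u < v.
  IsEdge : Fin n × Fin n → Set
  IsEdge p = proj₁ p ∈ W × proj₂ p ∈ W × proj₁ p <ᶠ proj₂ p × adj G (proj₁ p) (proj₂ p) ≡ true

  private
    isEdge? : ∀ p → Dec (IsEdge p)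
    isEdge? p =
      (proj₁ p ∈? W) ×-dec (proj₂ p ∈? W) ×-dec (proj₁ p <ᶠ? proj₂ p) ×-dec (adj G (proj₁ p) (proj₂ p) Bool.≟ true)

  edgeList : List (Fin n × Fin n)
  edgeList = filter isEdge? (cartesianProduct (allFin n) (allFin n))

  asMGraph : MGraph n (length edgeList)
  asMGraph = record { ends = lookupᴸ edgeList }

  private
    M = asMGraph

    ends-IsEdge : ∀ e → IsEdge (ends M e)
    ends-IsEdge e = proj₂ (∈-filter⁻ isEdge? {xs = cartesianProduct (allFin n) (allFin n)} (∈-lookup e))

    IsEdge⇒∃ends : ∀ {p} → IsEdge p → ∃ λ e → ends M e ≡ p
    IsEdge⇒∃ends p-edge = index p∈ , sym (lookup-index p∈)
      where p∈ = ∈-filter⁺ isEdge? (∈-cartesianProduct⁺ (∈-allFin _) (∈-allFin _)) p-edge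

    ends≡⇒< : ∀ {e u v} → ends M e ≡ (u , v) → u <ᶠ v
    ends≡⇒< {e} eq = proj₁ (proj₂ (proj₂ (subst IsEdge eq (ends-IsEdge e))))

    ends-injective : ∀ {e e′} → ends M e ≡ ends M e′ → e ≡ e′
    ends-injective = Unique⇒lookup-injective edgeList-unique _ _
      where
      edgeList-unique : Unique edgeList
      edgeList-unique = Unique.filter⁺ isEdge? (Unique.cartesianProduct⁺ (Unique.allFin⁺ n) (Unique.allFin⁺ n))

  Joins⇒adj : ∀ {e u v} → Joins M e u v → adj G u v ≡ true × v ∈ W
  Joins⇒adj {e} (inj₁ eq) with subst IsEdge eq (ends-IsEdge e)
  ... | _ , v∈W , _ , u~v = u~v , v∈W
  Joins⇒adj {e} {u} {v} (inj₂ eq) with subst IsEdge eq (ends-IsEdge e)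
  ... | v∈W , _ , _ , v~u = trans (Graph.sym G u v) v~u , v∈W

  adj⇒Joins : ∀ {u v} → u ∈ W → v ∈ W → adj G u v ≡ true → ∃ λ e → Joins M e u v
  adj⇒Joins {u} {v} u∈W v∈W u~v with <ᶠ-cmp u v
  ... | tri< u<v _ _ = let e , eq = IsEdge⇒∃ends (u∈W , v∈W , u<v , u~v) in e , inj₁ eq
  ... | tri≈ _ u≡v _ = ⊥-elim (adj⇒≢ G u~v u≡v)
  ... | tri> _ _ v<u = let e , eq = IsEdge⇒∃ends (v∈W , u∈W , v<u , trans (Graph.sym G v u) u~v) in e , inj₂ eq

  Joins-unique : ∀ {e e′ u v} → Joins M e u v → Joins M e′ u v → e ≡ e′
  Joins-unique {e} {e′} joins joins′ = ends-injective (ends≡ joins joins′)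
    where
    ends≡ : Joins M e _ _ → Joins M e′ _ _ → ends M e ≡ ends M e′
    ends≡ (inj₁ p) (inj₁ q) = trans p (sym q)
    ends≡ (inj₂ p) (inj₂ q) = trans p (sym q)
    ends≡ (inj₁ p) (inj₂ q) = ⊥-elim (<ᶠ-asym (ends≡⇒< p) (ends≡⇒< q))
    ends≡ (inj₂ p) (inj₁ q) = ⊥-elim (<ᶠ-asym (ends≡⇒< p) (ends≡⇒< q))

  MChain⇒ChainAdj : ∀ {u ws es} → MChain M (u ∷ ws) es → ChainAdj G (u ∷ ws) × All (_∈ W) ws
  MChain⇒ChainAdj {ws = []} {[]} _ = tt , []
  MChain⇒ChainAdj {ws = _ ∷ _} {_ ∷ _} (joins , chain) with Joins⇒adj joins | MChain⇒ChainAdj chain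
  ... | u~v , v∈W | chainAdj , ws⊆W = (u~v , chainAdj) , v∈W ∷ ws⊆W
  MChain⇒ChainAdj {ws = []} {_ ∷ _} ()
  MChain⇒ChainAdj {ws = _ ∷ _} {[]} ()

  ChainAdj⇒MChain : ∀ {u ws} → ChainAdj G (u ∷ ws) → All (_∈ W) (u ∷ ws) → ∃ (MChain M (u ∷ ws))
  ChainAdj⇒MChain {ws = []} _ _ = [] , tt
  ChainAdj⇒MChain {ws = _ ∷ _} (u~v , chain) (u∈W ∷ ws⊆W@(v∈W ∷ _))
    with adj⇒Joins u∈W v∈W u~v | ChainAdj⇒MChain chain ws⊆W
  ... | e , joins | es , mchain = e ∷ es , joins , mchain

  closed-MChain-long : ∀ {x xs es} → Unique es → MChain M (x ∷ xs ++ x ∷ []) es → 2 ≤ length xs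
  closed-MChain-long {xs = []} {_ ∷ []} _ (joins , _) = ⊥-elim (adj⇒≢ G (proj₁ (Joins⇒adj joins)) refl)
  closed-MChain-long {xs = _ ∷ []} {e ∷ e′ ∷ []} ((e≢e′ ∷ []) ∷ _) (joins , joins′ , _) =
    ⊥-elim (e≢e′ (Joins-unique joins (⊎-swap joins′)))
  closed-MChain-long {xs = _ ∷ _ ∷ _} _ _ = s≤s (s≤s z≤n)
  closed-MChain-long {xs = []} {[]} _ ()
  closed-MChain-long {xs = []} {_ ∷ _ ∷ _} _ (_ , ())
  closed-MChain-long {xs = _ ∷ []} {[]} _ ()
  closed-MChain-long {xs = _ ∷ []} {_ ∷ []} _ (_ , ())
  closed-MChain-long {xs = _ ∷ []} {_ ∷ _ ∷ _ ∷ _} _ (_ , _ , ())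

  MCycle⇒Cycle : MCycle M → Cycle G W
  MCycle⇒Cycle (mcyc x xs es uniqueV uniqueE chain) =
    cyc x xs ( closed-MChain-long uniqueE chain , uniqueV
             , All.head (All.++⁻ʳ xs xs∷x⊆W) ∷ All.++⁻ˡ xs xs∷x⊆W , proj₁ (MChain⇒ChainAdj chain))
    where
    xs∷x⊆W : All (_∈ W) (xs ++ x ∷ [])
    xs∷x⊆W = proj₂ (MChain⇒ChainAdj chain)

  Cycle⇒MCycle : (C : Cycle G W) → Σ (MCycle M) λ D → mverts D ≡ verts C
  Cycle⇒MCycle (cyc x xs (long , unique , x∈W ∷ xs⊆W , chainAdj))
    with ChainAdj⇒MChain chainAdj (x∈W ∷ All.++⁺ xs⊆W (x∈W ∷ []))
  ... | es , chain = mcyc x xs es unique (closed-MChain-Unique M unique long chain) chain , refl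

-- One stable class of binary vertices

module _ {n} (G : Graph n) (Z : Subset n) where

  toZ : Fin n → Fin n
  toZ v with v ∈? Z | nonempty? (N G v ∩ Z)
  ... | yes _ | _ = v
  ... | no _ | yes (z , _) = z
  ... | no _ | no _ = v

  toZ-∈ : ∀ {v} → v ∈ Z → toZ v ≡ v
  toZ-∈ {v} v∈Z with v ∈? Z
  ... | yes _ = refl
  ... | no v∉Z = ⊥-elim (v∉Z v∈Z)

  toZ-∉ : ∀ {v} → v ∉ Z → Nonempty (N G v ∩ Z) → toZ v ∈ N G v ∩ Z
  toZ-∉ {v} v∉Z nonempty with v ∈? Z | nonempty? (N G v ∩ Z)
  ... | yes v∈Z | _ = ⊥-elim (v∉Z v∈Z)
  ... | no _ | yes (_ , z∈) = z∈
  ... | no _ | no empty = ⊥-elim (empty nonempty)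

module _ {s φ : ℕ} (erdős-pósa : ErdosPosaBound s φ) {n} {G : Graph n} {Z P : Subset n}
         (sO-free : SOFree s G ⊤) (Z-stable : Stable G Z) (P-stable : Stable G P) (P⊆Binary : P ⊆ Binary G ⊤ Z) where

  open import Data.List.Membership.DecPropositional (_≟ᶠ_ {n}) using () renaming (_∈?_ to _∈ᴸ?_)

  private
    P-disjoint-Z : ∀ {b} → b ∈ P → b ∉ Z
    P-disjoint-Z b∈P = proj₁ (proj₂ (∈Binary⁻ G {⊤} {Z} (P⊆Binary b∈P)))

    degree≡2 : ∀ {b} → b ∈ P → ∣ N G b ∩ Z ∣ ≡ 2
    degree≡2 b∈P = proj₂ (proj₂ (∈Binary⁻ G {⊤} {Z} (P⊆Binary b∈P)))

    P-neighbour∈Z : ∀ {b p} → b ∈ P → p ∈ Z ∪ P → adj G b p ≡ true → p ∈ Z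
    P-neighbour∈Z b∈P p∈Z∪P b~p =
      [ id , (λ p∈P → ⊥-elim (Stable⇒¬adj G P-stable b∈P p∈P b~p)) ]′ (x∈p∪q⁻ Z P p∈Z∪P)

  -- b has two distinct neighbours on C, both in Z, and only two neighbours in Z altogether.
  Z-neighbour∈cycle : (C : Cycle G (Z ∪ P)) {b z : Fin n} → b ∈ᴸ verts C → b ∈ P → z ∈ Z → adj G b z ≡ true →
                      z ∈ᴸ verts C
  Z-neighbour∈cycle C {b} {z} b∈C b∈P z∈Z b~z with cycle-neighbours C b∈C | z ∈ᴸ? verts C
  ... | _ | yes z∈C = z∈C
  ... | p , q , p≢q , b~p , b~q , p∈C , q∈C | no z∉C =
    ⊥-elim (∣p∣≤2⇒¬three (N G b ∩ Z) (≤-reflexive (degree≡2 b∈P))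
      (neighbour p∈C b~p) (neighbour q∈C b~q) (x∈p∩q⁺ (∈N⁺ G b~z , z∈Z))
      p≢q (λ { refl → z∉C p∈C }) (λ { refl → z∉C q∈C }))
    where
    neighbour : ∀ {p} → p ∈ᴸ verts C → adj G b p ≡ true → p ∈ N G b ∩ Z
    neighbour p∈C b~p = x∈p∩q⁺ (∈N⁺ G b~p , P-neighbour∈Z b∈P (All.lookup (verts⊆ C) p∈C) b~p)

  disjoint⇒anticomplete : (C₁ C₂ : Cycle G (Z ∪ P)) → VDisjoint (verts C₁) (verts C₂) →
                          Anticomplete G (verts C₁) (verts C₂)
  disjoint⇒anticomplete C₁ C₂ disjoint {u} {v} u∈C₁ v∈C₂ = (λ { refl → disjoint u∈C₁ v∈C₂ }) , non-adjacent
    where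
    non-adjacent : adj G u v ≡ false
    non-adjacent with adj G u v in u~v
    ... | false = refl
    ... | true with x∈p∪q⁻ Z P (All.lookup (verts⊆ C₁) u∈C₁) | x∈p∪q⁻ Z P (All.lookup (verts⊆ C₂) v∈C₂)
    ...   | inj₁ u∈Z | inj₁ v∈Z = ⊥-elim (Stable⇒¬adj G Z-stable u∈Z v∈Z u~v)
    ...   | inj₂ u∈P | inj₂ v∈P = ⊥-elim (Stable⇒¬adj G P-stable u∈P v∈P u~v)
    ...   | inj₁ u∈Z | inj₂ v∈P =
      ⊥-elim (disjoint u∈C₁ (Z-neighbour∈cycle C₂ v∈C₂ v∈P u∈Z (trans (Graph.sym G v u) u~v)))
    ...   | inj₂ u∈P | inj₁ v∈Z = ⊥-elim (disjoint (Z-neighbour∈cycle C₁ u∈C₁ u∈P v∈Z u~v) v∈C₂)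

  private
    M = asMGraph G (Z ∪ P)

    hitting-set : Σ (Subset n) λ H → (∣ H ∣ ≤ φ) × (∀ (C : MCycle M) → Any (_∈ H) (mverts C))
    hitting-set = erdős-pósa n _ M λ (C , disjoint) →
      sO-free ((λ i → Cycle-mono ⊆⊤ (MCycle⇒Cycle G _ (C i))) ,
               λ i j i≢j → disjoint⇒anticomplete (MCycle⇒Cycle G _ (C i)) (MCycle⇒Cycle G _ (C j)) (disjoint i j i≢j))

    H = proj₁ hitting-set

  Y : Subset n
  Y = Z ∩ image (toZ G Z) H

  private
    survivors⊆Z∪P : ∀ X → (Z ─ X) ∪ (P ∩ explodeV G ⊤ Z X) ⊆ Z ∪ P
    survivors⊆Z∪P X = ∪-mono-⊆ (p─q⊆p Z X) (p∩q⊆p P _)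

    toZ-image⊆Y : ∀ {z h} → z ∈ Z → h ∈ H → toZ G Z h ≡ z → z ∈ Y
    toZ-image⊆Y z∈Z h∈H refl = x∈p∩q⁺ (z∈Z , x∈p⇒fx∈image (toZ G Z) h∈H)

  -- A cycle of survivors meets H in some h.  If h ∈ Z then h was exploded; otherwise both
  -- Z-neighbours of h lie on the cycle and toZ h, one of them, was exploded.
  explode-Acyclic : ∀ {X} → Y ⊆ X → Acyclic G ((Z ─ X) ∪ (P ∩ explodeV G ⊤ Z X))
  explode-Acyclic {X} Y⊆X C with Cycle⇒MCycle G (Z ∪ P) (Cycle-mono (survivors⊆Z∪P X) C)
  ... | D , mverts≡ with find (subst (Any (_∈ H)) mverts≡ (proj₂ (proj₂ hitting-set) D))
  ... | h , h∈C , h∈H with x∈p∪q⁻ (Z ─ X) _ (All.lookup (verts⊆ C) h∈C)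
  ...   | inj₁ h∈Z─X = let h∈Z , h∉X = x∈p─q⁻ Z X h∈Z─X in h∉X (Y⊆X (toZ-image⊆Y h∈Z h∈H (toZ-∈ G Z h∈Z)))
  ...   | inj₂ h∈P∩W′ = z∉ (x∈p∪q⁻ (Z ─ X) _ (All.lookup (verts⊆ C) z∈C))
    where
    h∈P = proj₁ (x∈p∩q⁻ P _ h∈P∩W′)
    z∈N∩Z : toZ G Z h ∈ N G h ∩ Z
    z∈N∩Z = toZ-∉ G Z (P-disjoint-Z h∈P) (1≤∣p∣⇒Nonempty _ (≤-trans (s≤s z≤n) (≤-reflexive (sym (degree≡2 h∈P)))))
    z∈Z = proj₂ (x∈p∩q⁻ (N G h) Z z∈N∩Z)
    z∈C : toZ G Z h ∈ᴸ verts C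
    z∈C = Z-neighbour∈cycle (Cycle-mono (survivors⊆Z∪P X) C) h∈C h∈P z∈Z
                            (∈N⁻ G (proj₁ (x∈p∩q⁻ (N G h) Z z∈N∩Z)))
    z∉ : toZ G Z h ∈ Z ─ X ⊎ toZ G Z h ∈ P ∩ explodeV G ⊤ Z X → ⊥
    z∉ (inj₁ z∈Z─X) = proj₂ (x∈p─q⁻ Z X z∈Z─X) (Y⊆X (toZ-image⊆Y z∈Z h∈H refl))
    z∉ (inj₂ z∈P∩W′) = P-disjoint-Z (proj₁ (x∈p∩q⁻ P _ z∈P∩W′)) z∈Z

  binary-class-explosion : Σ (Subset n) λ Y → Y ⊆ Z × ∣ Y ∣ ≤ φ ×
                             (∀ {X} → Y ⊆ X → ∣ P ∩ Binary G (explodeV G ⊤ Z X) (Z ─ X) ∣ ≤ ∣ Z ∣)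
  binary-class-explosion = Y , p∩q⊆p Z _ , ∣Y∣≤φ , survivors≤∣Z∣
    where
    ∣Y∣≤φ : ∣ Y ∣ ≤ φ
    ∣Y∣≤φ = ≤-trans (∣p∩q∣≤∣q∣ Z _) (≤-trans (∣image∣≤∣p∣ (toZ G Z) H) (proj₁ (proj₂ hitting-set)))
    survivors≤∣Z∣ : ∀ {X} → Y ⊆ X → ∣ P ∩ Binary G (explodeV G ⊤ Z X) (Z ─ X) ∣ ≤ ∣ Z ∣
    survivors≤∣Z∣ {X} Y⊆X = begin
      ∣ P ∩ Binary G (explodeV G ⊤ Z X) (Z ─ X) ∣  ≤⟨ p⊆q⇒∣p∣≤∣q∣ (∩-monoʳ-⊆ P (proj₁ ∘ ∈Binary⁻ G)) ⟩
      ∣ P ∩ explodeV G ⊤ Z X ∣                     ≤⟨ Acyclic⇒∣S∣≤∣A∣ G (explode-Acyclic Y⊆X) δ≥2 ⟩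
      ∣ Z ─ X ∣                                    ≤⟨ ∣p─q∣≤∣p∣ Z X ⟩
      ∣ Z ∣                                        ∎
      where
      open ≤-Reasoning
      δ≥2 : ∀ {b} → b ∈ P ∩ explodeV G ⊤ Z X → 2 ≤ ∣ N G b ∩ (Z ─ X) ∣
      δ≥2 {b} b∈ = let b∈P , b∈W′ = x∈p∩q⁻ P _ b∈ in
        ≤-trans (≤-reflexive (sym (degree≡2 b∈P))) (p⊆q⇒∣p∣≤∣q∣ (explode-N∩Z G b∈W′ (P-disjoint-Z b∈P)))

mainTheorem14 : ∀ (s : ℕ) → 1 ≤ s → ∀ (φ : ℕ) → ErdosPosaBound s φ →
    ∀ {n} (G : Graph n) (Z : Subset n) → Dyadic s G ⊤ Z →
    Σ (Subset n) λ X → (X ⊆ Z) × (∣ X ∣ ≤ 2 * φ)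
    × Dyadic s G (explodeV G ⊤ Z X) (Z ─ X)
    × (∣ Binary G (explodeV G ⊤ Z X) (Z ─ X) ∣ ≤ 2 * ∣ Z ∣)
mainTheorem14 s _ φ erdős-pósa G Z dyadic@((_ , sO-free , hitting) , Z-stable , _) =
  let B = Binary G ⊤ Z
      c , c-proper = Acyclic⇒ProperColouring G (Acyclic-mono (Binary⊆W─Z G) (CycleHitting⇒Acyclic hitting))
      R = tabulate c
      Y₁ , Y₁⊆Z , ∣Y₁∣≤φ , survivors₁ =
        binary-class-explosion erdős-pósa sO-free Z-stable (colour-class-stable G c-proper) (p∩q⊆p B R)
      Y₂ , Y₂⊆Z , ∣Y₂∣≤φ , survivors₂ =
        binary-class-explosion erdős-pósa sO-free Z-stable (colour-class-stable′ G c-proper) (p─q⊆p B R)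
  in Y₁ ∪ Y₂ ,
     [ Y₁⊆Z , Y₂⊆Z ]′ ∘ x∈p∪q⁻ Y₁ Y₂ ,
     ≤-trans (∣p∪q∣≤∣p∣+∣q∣ Y₁ Y₂) (m≤o⇒n≤o⇒m+n≤2*o ∣Y₁∣≤φ ∣Y₂∣≤φ) ,
     explode-Dyadic G dyadic ,
     ≤-trans (∣p∣≤∣[q∩r]∩p∣+∣[q─r]∩p∣ R (Binary-explode⊆ G {⊤} {Z} {Y₁ ∪ Y₂}))
             (m≤o⇒n≤o⇒m+n≤2*o (survivors₁ (p⊆p∪q Y₂)) (survivors₂ (q⊆p∪q Y₁ Y₂)))
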